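{- If a finite simple graph $G$ has $6$ vertices, has a Hamiltonian path, and $\alpha(G)=3$, then $G$ is not $\alpha^{++}$-stable.
   Context: $\alpha(G)$ is the maximum size of a stable set. For $e\in E(\overline{G})$ (a pair of distinct non-adjacent vertices), $G+e$ denotes $G$ with $e$ added. $G$ is $\alpha^{++}$-stable if $\alpha(G+e_1+e_2)=\alpha(G)$ for any $e_1,e_2\in E(\overline{G})$ (not necessarily distinct). -}

module Defs where

open import Data.Nat using (ℕ; suc)
open import Data.Fin using (Fin; inject₁; fromℕ<; toℕ) renaming (suc to fsuc)
open import Data.Bool using (Bool; true; false; _∨_; _∧_; T)
open import Data.List using (List; length)
open import Data.List.Relation.Unary.Unique.Propositional using (Unique)
open import Data.List.Relation.Unary.AllPairs using (AllPairs)
open import Data.List.Membership.Propositional using (_∈_)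
open import Data.Product using (Σ; _×_; ∃)
open import Relation.Nullary using (¬_; does; yes; no)
open import Data.Empty using (⊥-elim)
open import Data.Bool.Properties using (∧-comm; ∨-comm)
open import Data.Product using (_,_)
open import Relation.Binary.PropositionalEquality using (_≡_; refl; trans; cong₂)
open import Function.Definitions using (Injective)
import Data.Fin as F

record Graph (n : ℕ) : Set where
  field
    adj    : Fin n → Fin n → Bool
    sym    : ∀ x y → adj x y ≡ adj y x
    irrefl : ∀ x → adj x x ≡ false
open Graph public

Adj : ∀ {n} → Graph n → Fin n → Fin n → Set
Adj G x y = T (adj G x y)

IsStable : ∀ {n} → Graph n → List (Fin n) → Set
IsStable G S = Unique S × AllPairs (λ x y → ¬ Adj G x y) S

HasStable : ∀ {n} → Graph n → ℕ → Set
HasStable G k = Σ (List _) λ S → IsStable G S × length S ≡ k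

-- α(G) = k : there is a stable set of size k and none of size k+1
-- (stable sets are closed under subsets, so this says k is the maximum size).
AlphaIs : ∀ {n} → Graph n → ℕ → Set
AlphaIs G k = HasStable G k × ¬ HasStable G (suc k)

NonEdge : ∀ {n} → Graph n → Set
NonEdge {n} G = Σ (Fin n) λ u → Σ (Fin n) λ v → ¬ (u ≡ v) × ¬ Adj G u v

samePair : ∀ {n} → Fin n → Fin n → Fin n → Fin n → Bool
samePair x y u v =
  (does (x F.≟ u) ∧ does (y F.≟ v)) ∨ (does (x F.≟ v) ∧ does (y F.≟ u))

samePair-sym : ∀ {n} (x y u v : Fin n) → samePair x y u v ≡ samePair y x u v
samePair-sym x y u v =
  trans (cong₂ _∨_ (∧-comm (does (x F.≟ u)) _) (∧-comm (does (x F.≟ v)) _))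
        (∨-comm (does (y F.≟ v) ∧ does (x F.≟ u)) _)

samePair-irr : ∀ {n} (x u v : Fin n) → ¬ (u ≡ v) → samePair x x u v ≡ false
samePair-irr x u v u≢v with x F.≟ u | x F.≟ v
... | yes refl | yes refl = ⊥-elim (u≢v refl)
... | yes _    | no _     = refl
... | no _     | yes _    = refl
... | no _     | no _     = refl

addEdge : ∀ {n} (G : Graph n) → NonEdge G → Graph n
addEdge G (u , v , u≢v , _) = record
  { adj    = λ x y → adj G x y ∨ samePair x y u v
  ; sym    = λ x y → cong₂ _∨_ (Graph.sym G x y) (samePair-sym x y u v)
  ; irrefl = λ x → cong₂ _∨_ (irrefl G x) (samePair-irr x u v u≢v)
  }

-- G + e₁ + e₂ for non-edges e₁, e₂ of G;
-- if e₂ is already an edge of G+e₁ (i.e. e₂ = e₁), adding it changes nothing.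
addEdge₂ : ∀ {n} (G : Graph n) → NonEdge G → NonEdge G → Graph n
addEdge₂ G (u₁ , v₁ , p₁ , _) (u₂ , v₂ , p₂ , _) = record
  { adj    = λ x y → (adj G x y ∨ samePair x y u₁ v₁) ∨ samePair x y u₂ v₂
  ; sym    = λ x y → cong₂ _∨_ (cong₂ _∨_ (Graph.sym G x y) (samePair-sym x y u₁ v₁))
                                (samePair-sym x y u₂ v₂)
  ; irrefl = λ x → cong₂ _∨_ (cong₂ _∨_ (irrefl G x) (samePair-irr x u₁ v₁ p₁))
                              (samePair-irr x u₂ v₂ p₂)
  }

AlphaPlusPlusStable : ∀ {n} → Graph n → Set
AlphaPlusPlusStable G = ∀ (k : ℕ) → AlphaIs G k → ∀ (e₁ e₂ : NonEdge G) → AlphaIs (addEdge₂ G e₁ e₂) k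

-- A Hamiltonian path in a graph on n+1 vertices: an injective (hence bijective)
-- sequence p₀,…,pₙ of vertices with pᵢ adjacent to pᵢ₊₁.
HamiltonianPath : ∀ {n} → Graph (suc n) → Set
HamiltonianPath {n} G = Σ (Fin (suc n) → Fin (suc n)) λ p →
  Injective _≡_ _≡_ p × (∀ (i : Fin n) → Adj G (p (inject₁ i)) (p (fsuc i)))

{-# OPTIONS --safe #-}
-- Let p₀ … p₅ be the Hamiltonian path. Adding the chords p₀p₂ and p₃p₅ turns
-- {p₀, p₁, p₂} and {p₃, p₄, p₅} into triangles, so the vertex set of the new
-- graph is covered by two cliques and none of its stable sets has more than
-- two vertices, whereas α(G) = 3. A chord that is already an edge of G is
-- replaced by an arbitrary non-edge, which exists because α(G) ≥ 2.
module Submission where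

open import Defs hiding (sym)
open import Data.Nat using (ℕ; suc; _≤_)
open import Data.Nat.Properties using (1+n≰n)
open import Data.Fin using (Fin; zero; suc; _≟_; inject₁; combine; punchOut)
open import Data.Fin.Patterns using (0F; 1F; 2F; 3F; 4F; 5F)
open import Data.Fin.Properties using (any?; injective⇒≤; punchOut-injective; combine-surjective)
open import Data.Bool using (T; _∨_)
open import Data.Bool.Properties using (T-∨; T?)
open import Data.Unit using (tt)
open import Data.Product using (_×_; _,_; proj₁; ∃₂)
open import Data.Sum using (inj₁; inj₂)
open import Data.List using (List; _∷_; length; lookup)
open import Data.List.Properties using (length-map)
open import Data.List.Membership.Propositional.Properties using (∈-lookup)
open import Data.List.Relation.Unary.All as All using (_∷_)
open import Data.List.Relation.Unary.AllPairs as AllPairs using (_∷_)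
open import Data.List.Relation.Unary.AllPairs.Properties as AllPairsₚ using ()
open import Data.List.Relation.Unary.Unique.Propositional using (Unique)
open import Function using (_∘_; case_of_)
open import Function.Bundles using (Equivalence)
open import Function.Definitions using (Injective; StrictlySurjective)
open import Relation.Nullary using (¬_; yes; no; contradiction)
open import Relation.Nullary.Decidable using (dec-true)
open import Relation.Binary.PropositionalEquality using (_≡_; _≢_; refl; sym; trans; cong; subst)

private
  variable
    n m k : ℕ

Adj-sym : (G : Graph n) {x y : Fin n} → Adj G x y → Adj G y x
Adj-sym G {x} {y} = subst T (Graph.sym G x y)

_⊆ᴱ_ : Graph n → Graph n → Set
G ⊆ᴱ H = ∀ x y → Adj G x y → Adj H x y

IsClique : Graph n → (Fin m → Fin n) → Set
IsClique G f = ∀ {s t} → s ≢ t → Adj G (f s) (f t)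

record CliqueCover (G : Graph n) (k : ℕ) : Set where
  field
    part        : Fin n → Fin k
    part-clique : ∀ {x y} → part x ≡ part y → x ≢ y → Adj G x y
open CliqueCover

lookup-injective : {A : Set} {xs : List A} → Unique xs → Injective _≡_ _≡_ (lookup xs)
lookup-injective {xs = _ ∷ _} _          {zero}  {zero}  _  = refl
lookup-injective {xs = _ ∷ _} (x∉ ∷ _)   {zero}  {suc j} eq = contradiction eq (All.lookup x∉ (∈-lookup j))
lookup-injective {xs = _ ∷ _} (x∉ ∷ _)   {suc i} {zero}  eq = contradiction (sym eq) (All.lookup x∉ (∈-lookup i))
lookup-injective {xs = _ ∷ _} (_ ∷ uniq) {suc i} {suc j} eq = cong suc (lookup-injective uniq eq)

unique-length≤ : {xs : List (Fin k)} → Unique xs → length xs ≤ k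
unique-length≤ uniq = injective⇒≤ (lookup-injective uniq)

stable-length≤ : (G : Graph n) → CliqueCover G k → ∀ {S} → IsStable G S → length S ≤ k
stable-length≤ G cover {S} stable =
  subst (_≤ _) (length-map (part cover) S)
        (unique-length≤ (AllPairsₚ.map⁺ (AllPairs.zipWith separated stable)))
  where
  separated : ∀ {x y} → x ≢ y × ¬ Adj G x y → part cover x ≢ part cover y
  separated (x≢y , ¬xy) same = ¬xy (part-clique cover same x≢y)

cliqueCover⇒¬HasStable : (G : Graph n) → CliqueCover G k → ¬ HasStable G (suc k)
cliqueCover⇒¬HasStable G cover (S , stable , |S|≡1+k) =
  1+n≰n (subst (_≤ _) |S|≡1+k (stable-length≤ G cover stable))

rowCliques⇒CliqueCover : (G : Graph n) (q : Fin k → Fin m → Fin n) →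
                         (∀ x → ∃₂ λ b t → q b t ≡ x) → (∀ b → IsClique G (q b)) →
                         CliqueCover G k
rowCliques⇒CliqueCover G q q-onto rows =
  record { part = proj₁ ∘ q-onto ; part-clique = clique }
  where
  clique : ∀ {x y} → proj₁ (q-onto x) ≡ proj₁ (q-onto y) → x ≢ y → Adj G x y
  clique {x} {y} same x≢y with q-onto x | q-onto y | same
  ... | b , s , refl | .b , t , refl | refl = rows b (x≢y ∘ cong (q b))

triangle-isClique : (G : Graph n) {f : Fin 3 → Fin n} →
                    Adj G (f 0F) (f 1F) → Adj G (f 1F) (f 2F) → Adj G (f 0F) (f 2F) →
                    IsClique G f
triangle-isClique G f01 f12 f02 {0F} {0F} 0≢0 = contradiction refl 0≢0
triangle-isClique G f01 f12 f02 {0F} {1F} _   = f01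
triangle-isClique G f01 f12 f02 {0F} {2F} _   = f02
triangle-isClique G f01 f12 f02 {1F} {0F} _   = Adj-sym G f01
triangle-isClique G f01 f12 f02 {1F} {1F} 1≢1 = contradiction refl 1≢1
triangle-isClique G f01 f12 f02 {1F} {2F} _   = f12
triangle-isClique G f01 f12 f02 {2F} {0F} _   = Adj-sym G f02
triangle-isClique G f01 f12 f02 {2F} {1F} _   = Adj-sym G f12
triangle-isClique G f01 f12 f02 {2F} {2F} 2≢2 = contradiction refl 2≢2

injective⇒strictlySurjective : {f : Fin n → Fin n} →
                               Injective _≡_ _≡_ f → StrictlySurjective _≡_ f
injective⇒strictlySurjective {suc n} {f} f-inj y with any? (λ x → f x ≟ y)
... | yes found = found
... | no missed  = contradiction (injective⇒≤ punchOut-inj) 1+n≰n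
  where
  y≢f : ∀ x → y ≢ f x
  y≢f x y≡fx = missed (x , sym y≡fx)

  punchOut-inj : Injective _≡_ _≡_ (λ x → punchOut (y≢f x))
  punchOut-inj eq = f-inj (punchOut-injective (y≢f _) (y≢f _) eq)

hamiltonianPath-mono : {G H : Graph (suc n)} → G ⊆ᴱ H → HamiltonianPath G → HamiltonianPath H
hamiltonianPath-mono G⊆H (p , p-inj , p-adj) =
  p , p-inj , λ i → G⊆H (p (inject₁ i)) (p (suc i)) (p-adj i)

hamiltonianPath⇒CliqueCover : (G : Graph 6) ((p , _) : HamiltonianPath G) →
                              Adj G (p 0F) (p 2F) → Adj G (p 3F) (p 5F) → CliqueCover G 2
hamiltonianPath⇒CliqueCover G (p , p-inj , p-adj) p₀p₂ p₃p₅ =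
  rowCliques⇒CliqueCover G (λ b → p ∘ combine b) onto rows
  where
  onto : ∀ x → ∃₂ λ b t → p (combine b t) ≡ x
  onto x = let (i , pi≡x)     = injective⇒strictlySurjective p-inj x
               (b , t , bt≡i) = combine-surjective i
           in b , t , trans (cong p bt≡i) pi≡x

  -- combine b t = 3b + t, so the two rows are {p₀, p₁, p₂} and {p₃, p₄, p₅}.
  rows : ∀ b → IsClique G (p ∘ combine b)
  rows 0F = triangle-isClique G (p-adj 0F) (p-adj 1F) p₀p₂
  rows 1F = triangle-isClique G (p-adj 3F) (p-adj 4F) p₃p₅

hasStable⇒NonEdge : (G : Graph n) → HasStable G (suc (suc k)) → NonEdge G
hasStable⇒NonEdge G (x ∷ y ∷ _ , ((x≢y ∷ _) ∷ _ , (¬xy ∷ _) ∷ _) , _) = x , y , x≢y , ¬xy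

T-∨⁺ˡ : ∀ a b → T a → T (a ∨ b)
T-∨⁺ˡ a b = Equivalence.from (T-∨ {a} {b}) ∘ inj₁

T-∨⁺ʳ : ∀ a b → T b → T (a ∨ b)
T-∨⁺ʳ a b = Equivalence.from (T-∨ {a} {b}) ∘ inj₂

addEdge₂-⊇ : (G : Graph n) (e₁ e₂ : NonEdge G) → G ⊆ᴱ addEdge₂ G e₁ e₂
addEdge₂-⊇ G (u₁ , v₁ , _) (u₂ , v₂ , _) x y =
  T-∨⁺ˡ (adj G x y ∨ samePair x y u₁ v₁) (samePair x y u₂ v₂)
  ∘ T-∨⁺ˡ (adj G x y) (samePair x y u₁ v₁)

samePair-diag : (u v : Fin n) → T (samePair u v u v)
samePair-diag u v rewrite dec-true (u ≟ u) refl | dec-true (v ≟ v) refl = tt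

closing : (G : Graph n) (u v : Fin n) → u ≢ v → NonEdge G → NonEdge G
closing G u v u≢v d with T? (adj G u v)
... | yes _  = d
... | no ¬uv = u , v , u≢v , ¬uv

module _ (G : Graph n) {u v : Fin n} (u≢v : u ≢ v) (d : NonEdge G) where

  closing-adjˡ : (e : NonEdge G) → Adj (addEdge₂ G (closing G u v u≢v d) e) u v
  closing-adjˡ e@(u′ , v′ , _) with T? (adj G u v)
  ... | yes uv = addEdge₂-⊇ G d e u v uv
  ... | no _   = T-∨⁺ˡ (adj G u v ∨ samePair u v u v) (samePair u v u′ v′)
                       (T-∨⁺ʳ (adj G u v) (samePair u v u v) (samePair-diag u v))

  closing-adjʳ : (e : NonEdge G) → Adj (addEdge₂ G e (closing G u v u≢v d)) u v
  closing-adjʳ e@(u′ , v′ , _) with T? (adj G u v)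
  ... | yes uv = addEdge₂-⊇ G e d u v uv
  ... | no _   = T-∨⁺ʳ (adj G u v ∨ samePair u v u′ v′) (samePair u v u v) (samePair-diag u v)

lemma4 : (G : Graph 6) → HamiltonianPath G → AlphaIs G 3 → ¬ AlphaPlusPlusStable G
lemma4 G path@(p , p-inj , _) α≡3@(stable₃ , _) α⁺⁺ =
  cliqueCover⇒¬HasStable G′ cover (proj₁ (α⁺⁺ 3 α≡3 e₁ e₂))
  where
  d : NonEdge G
  d = hasStable⇒NonEdge G stable₃

  p₀≢p₂ : p 0F ≢ p 2F
  p₀≢p₂ eq = case p-inj eq of λ ()

  p₃≢p₅ : p 3F ≢ p 5F
  p₃≢p₅ eq = case p-inj eq of λ ()

  e₁ e₂ : NonEdge G
  e₁ = closing G (p 0F) (p 2F) p₀≢p₂ d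
  e₂ = closing G (p 3F) (p 5F) p₃≢p₅ d

  G′ : Graph 6
  G′ = addEdge₂ G e₁ e₂

  cover : CliqueCover G′ 2
  cover = hamiltonianPath⇒CliqueCover G′
            (hamiltonianPath-mono {G = G} {H = G′} (addEdge₂-⊇ G e₁ e₂) path)
            (closing-adjˡ G p₀≢p₂ d e₂)
            (closing-adjʳ G p₃≢p₅ d e₁)
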